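{- Let $\alpha=\sqrt2$, $A(n)=\lfloor n\alpha\rfloor$ for $n\ge1$, and $\Delta AA=(A(A(n+1))-A(A(n)))_{n\ge1}=1,3,2,2,2,1,3,1,3,2,\dots$. Let $\sigma$ be the morphism on $\{1,2,3\}$ given by $\sigma(1)=123$, $\sigma(2)=1$, $\sigma(3)=121$, and $\delta$ the morphism given by $\delta(1)=13$, $\delta(2)=2$, $\delta(3)=22$. Then $\Delta AA=\delta(x)$, where $x$ is the fixed point of $\sigma$ (starting with $1$).
   Context: $\delta(x)$ denotes the concatenation $\delta(x_1)\delta(x_2)\cdots$; $\Delta AA$ is regarded as an infinite word over the positive integers. -}

module Defs where

open import Data.Nat using (ℕ; zero; suc; _+_; _*_; _∸_; _≤?_)
open import Data.List using (List; []; _∷_; concatMap)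
open import Data.Product using (_×_)
open import Data.Unit using (⊤)
open import Relation.Binary.PropositionalEquality using (_≡_)
open import Relation.Nullary.Decidable using (does)
open import Data.Bool using (if_then_else_)

isqrt : ℕ → ℕ
isqrt zero = zero
isqrt (suc k) with isqrt k
... | r = if does (suc r * suc r ≤? suc k) then suc r else r

-- A(n) = ⌊n√2⌋ = ⌊√(2n²)⌋
A : ℕ → ℕ
A n = isqrt (2 * (n * n))

-- ΔAA, 0-indexed: ΔAA i = A(A(i+2)) - A(A(i+1)), i.e. the paper's n = i+1
ΔAA : ℕ → ℕ
ΔAA i = A (A (suc (suc i))) ∸ A (A (suc i))

data Letter : Set where
  l1 l2 l3 : Letter

σ : Letter → List Letter
σ l1 = l1 ∷ l2 ∷ l3 ∷ []
σ l2 = l1 ∷ []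
σ l3 = l1 ∷ l2 ∷ l1 ∷ []

δ : Letter → List ℕ
δ l1 = 1 ∷ 3 ∷ []
δ l2 = 2 ∷ []
δ l3 = 2 ∷ 2 ∷ []

take : {B : Set} → ℕ → (ℕ → B) → List B
take zero w = []
take (suc n) w = w 0 ∷ take n (λ i → w (suc i))

Prefix : {B : Set} → List B → (ℕ → B) → Set
Prefix [] y = ⊤
Prefix (b ∷ l) y = (b ≡ y 0) × Prefix l (λ i → y (suc i))

-- y = h(w) = h(w 0) h(w 1) ⋯ for a non-erasing morphism h:
-- every h(w 0 ⋯ w (n-1)) is a prefix of y
IsImage : {B C : Set} → (B → List C) → (ℕ → B) → (ℕ → C) → Set
IsImage h w y = ∀ n → Prefix (concatMap h (take n w)) y

module Submission where

-- Write m k = ⌈⌊k√2⌋/2⌉ and θ_k = k√2 - 2 m k ∈ [-1, 1]; x_k is 3, 1 or 2 according as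
-- θ_k ≥ 2 - √2, θ_k ≥ 1 - √2 or neither. Then m increases exactly at the letters 1 and 3,
-- so L k = k + 2 m k and P k = k + m k advance by |σ(x_k)| and |δ(x_k)|. Multiplication by
-- the unit √2 - 1 of ℤ[√2] carries θ_k, up to integer shifts, to θ at L k, L k + 1, L k + 2,
-- which forces the letters of σ(x_k) there; the same scaled inequalities pin down A(A(n))
-- for n near P k, so ΔAA reads δ(x_k) at P k. Every inequality is an exact statement in
-- ℤ[√2], ordered by a + b√2 ≥ 0 ⇔ -a ≤ ⌊b√2⌋, and irrationality of √2 makes this order
-- antisymmetric. The fixed point is unique because |σ(1)| > 1.

open import Defs
open import Data.Bool using (if_then_else_)
open import Data.Nat
open import Data.Nat.Properties
open import Data.Nat.Divisibility using (_∣_; divides)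
open import Data.Nat.Induction using (<-rec)
open import Data.Nat.Primality using (euclidsLemma; prime[2])
open import Data.Nat.Tactic.RingSolver using (solve-∀)
import Data.Integer as ℤ
import Data.Integer.Properties as ℤₚ
open ℤ using (ℤ; +_; -[1+_]; _⊖_; +≤+; -≤-; -≤+; +<+; -<-)
open import Data.Integer.Tactic.RingSolver using (solve)
open import Data.List using (List; _∷_; []; _++_; length; concatMap)
open import Data.List.Properties using (length-++)
open import Data.Unit using (tt)
open import Data.Product using (Σ; _×_; _,_; proj₁; proj₂)
open import Data.Sum using (_⊎_; inj₁; inj₂; [_,_]′)
open import Function using (id; _$_; _∘_)
open import Relation.Nullary using (¬_; yes; no; Dec; contradiction)
open import Relation.Nullary.Decidable using (does; map′; True; False; toWitness; toWitnessFalse)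
open import Relation.Binary.PropositionalEquality

-- ⌊n√2⌋ and the irrationality of √2

square-cancel-≤ : ∀ {a b} → a * a ≤ b * b → a ≤ b
square-cancel-≤ {a} {b} a²≤b² with a ≤? b
... | yes a≤b = a≤b
... | no a≰b = contradiction a²≤b² (<⇒≱ (*-mono-< (≰⇒> a≰b) (≰⇒> a≰b)))

square-cancel-< : ∀ {a b} → a * a < b * b → a < b
square-cancel-< {a} {b} a²<b² with a <? b
... | yes a<b = a<b
... | no a≮b = contradiction (*-mono-≤ (≮⇒≥ a≮b) (≮⇒≥ a≮b)) (<⇒≱ a²<b²)

isqrt-spec : ∀ k → isqrt k * isqrt k ≤ k × k < suc (isqrt k) * suc (isqrt k)
isqrt-spec zero = z≤n , s≤s z≤n
isqrt-spec (suc k) = step (suc r * suc r ≤? suc k)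
  where
  r = isqrt k
  step : (d : Dec (suc r * suc r ≤ suc k)) →
         let s = if does d then suc r else r in s * s ≤ suc k × suc k < suc s * suc s
  step (yes [r+1]²≤k+1) =
    [r+1]²≤k+1 , ≤-<-trans (proj₂ (isqrt-spec k)) (*-mono-< (n<1+n (suc r)) (n<1+n (suc r)))
  step (no [r+1]²≰k+1) = m≤n⇒m≤1+n (proj₁ (isqrt-spec k)) , ≰⇒> [r+1]²≰k+1

isqrt-greatest : ∀ s n → s * s ≤ n → s ≤ isqrt n
isqrt-greatest s n s²≤n = ≤-pred (square-cancel-< (≤-<-trans s²≤n (proj₂ (isqrt-spec n))))

isqrt-least : ∀ s n → n < s * s → isqrt n < s
isqrt-least s n n<s² = square-cancel-< (≤-<-trans (proj₁ (isqrt-spec n)) n<s²)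

A-lower : ∀ n → A n * A n ≤ 2 * (n * n)
A-lower n = proj₁ (isqrt-spec (2 * (n * n)))

A-upper : ∀ n → 2 * (n * n) < suc (A n) * suc (A n)
A-upper n = proj₂ (isqrt-spec (2 * (n * n)))

-- The floor laws ⌊x⌋ + ⌊y⌋ ≤ ⌊x + y⌋ ≤ ⌊x⌋ + ⌊y⌋ + 1 for x = u√2, y = v√2, proved by
-- squaring: the cross term satisfies A u * A v ≤ 2uv < (A u + 1)(A v + 1).
module _ (u v : ℕ) where
  private
    a = A u
    b = A v

    square-+ : ∀ a b → (a + b) * (a + b) ≡ a * a + 2 * (a * b) + b * b
    square-+ = solve-∀

    twice-square-+ : ∀ u v →
      2 * ((u + v) * (u + v)) ≡ 2 * (u * u) + 2 * (2 * (u * v)) + 2 * (v * v)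
    twice-square-+ = solve-∀

    doubled-squares : ∀ u v → (2 * (u * v)) * (2 * (u * v)) ≡ (2 * (u * u)) * (2 * (v * v))
    doubled-squares = solve-∀

    square-2+ : ∀ a b →
      (2 + (a + b)) * (2 + (a + b)) ≡ suc a * suc a + 2 * (suc a * suc b) + suc b * suc b
    square-2+ = solve-∀

  A-superadditive : A u + A v ≤ A (u + v)
  A-superadditive = isqrt-greatest (a + b) (2 * ((u + v) * (u + v))) (begin
    (a + b) * (a + b)                             ≡⟨ square-+ a b ⟩
    a * a + 2 * (a * b) + b * b
      ≤⟨ +-mono-≤ (+-mono-≤ (A-lower u) (*-monoʳ-≤ 2 ab≤2uv)) (A-lower v) ⟩
    2 * (u * u) + 2 * (2 * (u * v)) + 2 * (v * v) ≡⟨ twice-square-+ u v ⟨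
    2 * ((u + v) * (u + v))                       ∎)
    where
    open ≤-Reasoning
    ab≤2uv : a * b ≤ 2 * (u * v)
    ab≤2uv = square-cancel-≤ (begin
      (a * b) * (a * b)               ≡⟨ [m*n]*[o*p]≡[m*o]*[n*p] a b a b ⟩
      (a * a) * (b * b)               ≤⟨ *-mono-≤ (A-lower u) (A-lower v) ⟩
      (2 * (u * u)) * (2 * (v * v))   ≡⟨ doubled-squares u v ⟨
      (2 * (u * v)) * (2 * (u * v))   ∎)

  A-subadditive : A (u + v) ≤ suc (A u + A v)
  A-subadditive = ≤-pred (isqrt-least (2 + (a + b)) (2 * ((u + v) * (u + v))) (begin-strict
    2 * ((u + v) * (u + v))                             ≡⟨ twice-square-+ u v ⟩
    2 * (u * u) + 2 * (2 * (u * v)) + 2 * (v * v)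
      <⟨ +-mono-< (+-mono-< (A-upper u) (*-monoʳ-< 2 2uv<[a+1][b+1])) (A-upper v) ⟩
    suc a * suc a + 2 * (suc a * suc b) + suc b * suc b ≡⟨ square-2+ a b ⟨
    (2 + (a + b)) * (2 + (a + b))                       ∎))
    where
    open ≤-Reasoning
    2uv<[a+1][b+1] : 2 * (u * v) < suc a * suc b
    2uv<[a+1][b+1] = square-cancel-< (begin-strict
      (2 * (u * v)) * (2 * (u * v))       ≡⟨ doubled-squares u v ⟩
      (2 * (u * u)) * (2 * (v * v))       <⟨ *-mono-< (A-upper u) (A-upper v) ⟩
      (suc a * suc a) * (suc b * suc b)   ≡⟨ [m*n]*[o*p]≡[m*o]*[n*p] (suc a) (suc a) (suc b) (suc b) ⟩
      (suc a * suc b) * (suc a * suc b)   ∎)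

2∣n*n⇒2∣n : ∀ {n} → 2 ∣ n * n → 2 ∣ n
2∣n*n⇒2∣n {n} 2∣n² = [ id , id ]′ (euclidsLemma n n prime[2] 2∣n²)

-- Infinite descent: a = 2b forces n = 2c and b² = 2c², with b < a unless a = 0.
a*a≡2*n*n⇒a≡0 : ∀ a n → a * a ≡ 2 * (n * n) → a ≡ 0
a*a≡2*n*n⇒a≡0 = <-rec _ descent
  where
  halve-equation : ∀ b n → (b * 2) * (b * 2) ≡ 2 * (n * n) → n * n ≡ 2 * (b * b)
  halve-equation b n eq = *-cancelˡ-≡ (n * n) (2 * (b * b)) 2 (trans (sym eq) (four-squares b))
    where
    four-squares : ∀ b → (b * 2) * (b * 2) ≡ 2 * (2 * (b * b))
    four-squares = solve-∀
  even-root : ∀ a n → a * a ≡ 2 * n → 2 ∣ a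
  even-root a n a²≡2n = 2∣n*n⇒2∣n (divides n (trans a²≡2n (*-comm 2 n)))
  descent : ∀ a → (∀ {b} → b < a → ∀ n → b * b ≡ 2 * (n * n) → b ≡ 0) →
            ∀ n → a * a ≡ 2 * (n * n) → a ≡ 0
  descent a rec n a²≡2n² with even-root a (n * n) a²≡2n²
  ... | divides zero refl = refl
  ... | divides b@(suc _) refl with even-root n (b * b) (halve-equation b n a²≡2n²)
  ...   | divides c refl = contradiction
    (rec (m<m*n b 2 (s≤s (s≤s z≤n))) c (halve-equation c b (halve-equation b (c * 2) a²≡2n²))) λ ()

-- For n > 0, n√2 is irrational, so ⌊-n√2⌋ = -(⌊n√2⌋ + 1).
⌊_√2⌋ : ℤ → ℤ
⌊ + n √2⌋ = + A n
⌊ -[1+ n ] √2⌋ = -[1+ A (suc n) ]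

⊖-≤-+ : ∀ {a b c} → a ≤ c + b → a ⊖ b ℤ.≤ + c
⊖-≤-+ {a} {b} {c} a≤c+b = ℤₚ.≤-trans (ℤₚ.⊖-monoˡ-≤ b a≤c+b)
  (ℤₚ.≤-reflexive (trans (ℤₚ.≤-⊖ (m≤n+m b c)) (cong +_ (m+n∸n≡m c b))))

⊖-≤-+⁻¹ : ∀ a b c → a ⊖ b ℤ.≤ + c → a ≤ c + b
⊖-≤-+⁻¹ zero b c _ = z≤n
⊖-≤-+⁻¹ (suc a) zero c (+≤+ a+1≤c) = subst (suc a ≤_) (sym (+-identityʳ c)) a+1≤c
⊖-≤-+⁻¹ (suc a) (suc b) c a⊖b≤c rewrite ℤₚ.[1+m]⊖[1+n]≡m⊖n a b =
  subst (suc a ≤_) (sym (+-suc c b)) (s≤s (⊖-≤-+⁻¹ a b c a⊖b≤c))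

⊖-≤-neg : ∀ {a b c} → a + suc c ≤ b → a ⊖ b ℤ.≤ -[1+ c ]
⊖-≤-neg {a} {b} {c} a+c<b = ℤₚ.≤-trans (ℤₚ.⊖-monoʳ-≥-≤ a a+c<b)
  (ℤₚ.≤-reflexive (trans (cong (_⊖ (a + suc c)) (sym (+-identityʳ a))) (ℤₚ.+-cancelˡ-⊖ a 0 (suc c))))

offset-comparison : ∀ n m → Σ ℕ (λ j → n ≡ suc m + j) ⊎ Σ ℕ (λ j → suc m ≡ n + suc j)
offset-comparison zero m = inj₂ (m , refl)
offset-comparison (suc n) zero = inj₁ (n , refl)
offset-comparison (suc n) (suc m) with offset-comparison n m
... | inj₁ (j , n≡m+j) = inj₁ (j , cong suc n≡m+j)
... | inj₂ (j , m≡n+j) = inj₂ (j , cong suc m≡n+j)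

⌊√2⌋-superadditive-mixed : ∀ n m → ⌊ + n √2⌋ ℤ.+ ⌊ -[1+ m ] √2⌋ ℤ.≤ ⌊ + n ℤ.+ -[1+ m ] √2⌋
⌊√2⌋-superadditive-mixed n m with offset-comparison n m
... | inj₁ (j , refl) = ℤₚ.≤-trans (⊖-≤-+ A[m+j]≤A[j]+A[m]+1)
  (ℤₚ.≤-reflexive (cong ⌊_√2⌋ (sym m+j⊖m≡j)))
  where
  m+j⊖m≡j : (suc m + j) ⊖ suc m ≡ + j
  m+j⊖m≡j = trans (ℤₚ.⊖-≥ (m≤m+n (suc m) j)) (cong +_ (m+n∸m≡n (suc m) j))
  A[m+j]≤A[j]+A[m]+1 : A (suc m + j) ≤ A j + suc (A (suc m))
  A[m+j]≤A[j]+A[m]+1 = ≤-trans (A-subadditive (suc m) j)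
    (≤-reflexive (trans (cong suc (+-comm (A (suc m)) (A j))) (sym (+-suc (A j) (A (suc m))))))
... | inj₂ (j , m≡n+j) = ℤₚ.≤-trans (⊖-≤-neg A[n]+A[j]<A[m])
  (ℤₚ.≤-reflexive (cong ⌊_√2⌋ (sym (trans (ℤₚ.⊖-< n<m) (cong (λ x → ℤ.- + x) m∸n≡j)))))
  where
  A[n]+A[j]<A[m] : A n + suc (A (suc j)) ≤ suc (A (suc m))
  A[n]+A[j]<A[m] = subst (_≤ suc (A (suc m))) (sym (+-suc (A n) (A (suc j))))
    (s≤s (subst (λ x → A n + A (suc j) ≤ A x) (sym m≡n+j) (A-superadditive n (suc j))))
  n<m : n < suc m
  n<m = subst (n <_) (sym m≡n+j) (m<m+n n z<s)
  m∸n≡j : suc m ∸ n ≡ suc j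
  m∸n≡j = trans (cong (_∸ n) m≡n+j) (m+n∸m≡n n (suc j))

⌊√2⌋-superadditive : ∀ b d → ⌊ b √2⌋ ℤ.+ ⌊ d √2⌋ ℤ.≤ ⌊ b ℤ.+ d √2⌋
⌊√2⌋-superadditive (+ n) (+ m) = +≤+ (A-superadditive n m)
⌊√2⌋-superadditive (+ n) -[1+ m ] = ⌊√2⌋-superadditive-mixed n m
⌊√2⌋-superadditive -[1+ n ] (+ m) =
  subst₂ ℤ._≤_ (ℤₚ.+-comm ⌊ + m √2⌋ ⌊ -[1+ n ] √2⌋) (cong ⌊_√2⌋ (ℤₚ.+-comm (+ m) -[1+ n ]))
    (⌊√2⌋-superadditive-mixed m n)
⌊√2⌋-superadditive -[1+ n ] -[1+ m ] = -≤- (subst (λ x → A x ≤ suc (A (suc n) + A (suc m)))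
  (+-suc (suc n) m) (A-subadditive (suc n) (suc m)))

-- The ordered ring ℤ[√2]

infix 5 _⊹_
infixl 6 _⊕_
infixl 7 _⊗_

-- a ⊹ b stands for a + b√2.
data ℤ[√2] : Set where
  _⊹_ : ℤ → ℤ → ℤ[√2]

rat irr : ℤ[√2] → ℤ
rat (a ⊹ _) = a
irr (_ ⊹ b) = b

_⊕_ : ℤ[√2] → ℤ[√2] → ℤ[√2]
(a ⊹ b) ⊕ (c ⊹ d) = (a ℤ.+ c) ⊹ (b ℤ.+ d)

_⊗_ : ℤ[√2] → ℤ[√2] → ℤ[√2]
(a ⊹ b) ⊗ (c ⊹ d) = (a ℤ.* c ℤ.+ (b ℤ.* d ℤ.+ b ℤ.* d)) ⊹ (a ℤ.* d ℤ.+ b ℤ.* c)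

neg : ℤ[√2] → ℤ[√2]
neg (a ⊹ b) = ℤ.- a ⊹ ℤ.- b

√2·_ : ℤ[√2] → ℤ[√2]
√2· (a ⊹ b) = (b ℤ.+ b) ⊹ a

0# 1# √2-1 √2+1 : ℤ[√2]
0# = + 0 ⊹ + 0
1# = + 1 ⊹ + 0
√2-1 = ℤ.- + 1 ⊹ + 1
√2+1 = + 1 ⊹ + 1

-- a + b√2 ≥ 0 iff -a ≤ ⌊b√2⌋.
data NonNeg : ℤ[√2] → Set where
  nonNeg : ∀ {a b} → ℤ.- a ℤ.≤ ⌊ b √2⌋ → NonNeg (a ⊹ b)

nonNeg? : ∀ w → Dec (NonNeg w)
nonNeg? (a ⊹ b) = map′ nonNeg (λ { (nonNeg -a≤⌊b√2⌋) → -a≤⌊b√2⌋ }) (ℤ.- a ℤₚ.≤? ⌊ b √2⌋)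

NonNeg-⊕ : ∀ {v w} → NonNeg v → NonNeg w → NonNeg (v ⊕ w)
NonNeg-⊕ (nonNeg {a} {b} v≥0) (nonNeg {c} {d} w≥0) = nonNeg $
  subst (ℤ._≤ ⌊ b ℤ.+ d √2⌋) (sym (ℤₚ.neg-distrib-+ a c))
    (ℤₚ.≤-trans (ℤₚ.+-mono-≤ v≥0 w≥0) (⌊√2⌋-superadditive b d))

A-≥-double : ∀ p n → suc (A (suc n)) ≤ p → 2 + (n + n) ≤ A p
A-≥-double p n A[n+1]<p = isqrt-greatest (2 + (n + n)) (2 * (p * p)) (begin
  (2 + (n + n)) * (2 + (n + n)) ≡⟨ square-double n ⟩
  2 * (2 * (suc n * suc n))
    ≤⟨ *-monoʳ-≤ 2 (<⇒≤ (<-≤-trans (A-upper (suc n)) (*-mono-≤ A[n+1]<p A[n+1]<p))) ⟩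
  2 * (p * p)                   ∎)
  where
  open ≤-Reasoning
  square-double : ∀ n → (2 + (n + n)) * (2 + (n + n)) ≡ 2 * (2 * (suc n * suc n))
  square-double = solve-∀

-- If t + 1 ≤ n√2 then (t + 1)√2 < 2n, strictly because √2 is irrational.
A-<-double : ∀ t n → suc t ≤ A n → A (suc t) < n + n
A-<-double t n t<A[n] = ≤∧≢⇒< (square-cancel-≤ (≤-trans (A-lower (suc t)) 2[t+1]²≤[2n]²)) A[t+1]≢2n
  where
  square-double : ∀ n → (n + n) * (n + n) ≡ 2 * (2 * (n * n))
  square-double = solve-∀
  2[t+1]²≤[2n]² : 2 * (suc t * suc t) ≤ (n + n) * (n + n)
  2[t+1]²≤[2n]² = subst (2 * (suc t * suc t) ≤_) (sym (square-double n))
    (*-monoʳ-≤ 2 (≤-trans (*-mono-≤ t<A[n] t<A[n]) (A-lower n)))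
  A[t+1]≢2n : A (suc t) ≢ n + n
  A[t+1]≢2n A[t+1]≡2n = contradiction (subst (λ x → suc t ≤ A x) n≡0 t<A[n]) λ ()
    where
    2n≡0 : n + n ≡ 0
    2n≡0 = a*a≡2*n*n⇒a≡0 (n + n) (suc t)
      (≤-antisym (subst (λ x → x * x ≤ 2 * (suc t * suc t)) A[t+1]≡2n (A-lower (suc t))) 2[t+1]²≤[2n]²)
    n≡0 : n ≡ 0
    n≡0 = m+n≡0⇒m≡0 n 2n≡0

NonNeg-√2· : ∀ {w} → NonNeg w → NonNeg (√2· w)
NonNeg-√2· (nonNeg {+ p} {+ n} _) = nonNeg ℤₚ.neg-≤-pos
NonNeg-√2· (nonNeg {+ suc p} { -[1+ n ]} (-≤- n√2≤p)) =
  nonNeg (+≤+ (A-≥-double (suc p) n (s≤s n√2≤p)))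
NonNeg-√2· (nonNeg { -[1+ t ]} {+ suc n} (+≤+ t<n√2)) =
  nonNeg (-≤- (≤-pred (A-<-double t (suc n) t<n√2)))
NonNeg-√2· (nonNeg {+ zero} { -[1+ n ]} ())
NonNeg-√2· (nonNeg { -[1+ t ]} {+ zero} (+≤+ ()))
NonNeg-√2· (nonNeg { -[1+ t ]} { -[1+ n ]} ())

NonNeg-0# : NonNeg 0#
NonNeg-0# = nonNeg (+≤+ z≤n)

<-neg⇒≤-[1+] : ∀ {x} k → x ℤ.< ℤ.- + k → x ℤ.≤ -[1+ k ]
<-neg⇒≤-[1+] {+ _} zero (+<+ ())
<-neg⇒≤-[1+] { -[1+ _ ]} zero _ = -≤- z≤n
<-neg⇒≤-[1+] { -[1+ _ ]} (suc k) (-<- k<x) = -≤- k<x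

<-+suc⇒≤ : ∀ {x} k → x ℤ.< + suc k → x ℤ.≤ + k
<-+suc⇒≤ {+ _} k (+<+ x<k+1) = +≤+ (≤-pred x<k+1)
<-+suc⇒≤ { -[1+ _ ]} k _ = -≤+

NonNeg-total : ∀ w → NonNeg w ⊎ NonNeg (neg w)
NonNeg-total (a ⊹ b) with ℤ.- a ℤₚ.≤? ⌊ b √2⌋
... | yes w≥0 = inj₁ (nonNeg w≥0)
... | no w≱0 = inj₂ $ nonNeg (subst (ℤ._≤ ⌊ ℤ.- b √2⌋) (sym (ℤₚ.neg-involutive a))
                      (below b (subst (ℤ.- ⌊ b √2⌋ ℤ.>_) (ℤₚ.neg-involutive a) (ℤₚ.neg-mono-< (ℤₚ.≰⇒> w≱0)))))
  where
  below : ∀ b → a ℤ.< ℤ.- ⌊ b √2⌋ → a ℤ.≤ ⌊ ℤ.- b √2⌋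
  below (+ zero) a<0 = ℤₚ.<⇒≤ a<0
  below (+ suc n) a<-A[n] = <-neg⇒≤-[1+] (A (suc n)) a<-A[n]
  below -[1+ n ] a<A[n]+1 = <-+suc⇒≤ (A (suc n)) a<A[n]+1

¬NonNeg⇒NonNeg-neg : ∀ {w} → ¬ NonNeg w → NonNeg (neg w)
¬NonNeg⇒NonNeg-neg {w} w≱0 with NonNeg-total w
... | inj₁ w≥0 = contradiction w≥0 w≱0
... | inj₂ -w≥0 = -w≥0

NonNeg-antisym : ∀ {w} → NonNeg w → NonNeg (neg w) → w ≡ 0#
NonNeg-antisym (nonNeg {a} {b} w≥0) (nonNeg -w≥0) =
  by-cases b w≥0 (subst (ℤ._≤ ⌊ ℤ.- b √2⌋) (ℤₚ.neg-involutive a) -w≥0)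
  where
  -k≰-1-k : ∀ k → ¬ (ℤ.- + k ℤ.≤ -[1+ k ])
  -k≰-1-k zero ()
  -k≰-1-k (suc k) (-≤- k+1≤k) = 1+n≰n k+1≤k
  by-cases : ∀ b → ℤ.- a ℤ.≤ ⌊ b √2⌋ → a ℤ.≤ ⌊ ℤ.- b √2⌋ → a ⊹ b ≡ 0#
  by-cases (+ zero) -a≤0 a≤0 =
    cong (_⊹ + 0) (ℤₚ.≤-antisym a≤0 (subst (+ 0 ℤ.≤_) (ℤₚ.neg-involutive a) (ℤₚ.neg-mono-≤ -a≤0)))
  by-cases (+ suc n) -a≤A a≤-A-1 =
    contradiction (ℤₚ.drop‿+≤+ (ℤₚ.≤-trans (ℤₚ.neg-mono-≤ a≤-A-1) -a≤A)) 1+n≰n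
  by-cases -[1+ n ] -a≤-A-1 a≤A =
    contradiction (ℤₚ.≤-trans (ℤₚ.neg-mono-≤ a≤A) -a≤-A-1) (-k≰-1-k (A (suc n)))

NonNeg-by-contraposition : ∀ {v w} → NonNeg v →
  (NonNeg (neg w) → NonNeg (neg v)) → (v ≡ 0# → w ≡ 0#) → NonNeg w
NonNeg-by-contraposition {v} {w} v≥0 -w≥0⇒-v≥0 v≡0⇒w≡0 with NonNeg-total w
... | inj₁ w≥0 = w≥0
... | inj₂ -w≥0 = subst NonNeg (sym (v≡0⇒w≡0 (NonNeg-antisym v≥0 (-w≥0⇒-v≥0 -w≥0)))) NonNeg-0#

¬NonNeg-by-neg : ∀ {v w} → neg w ≡ v → NonNeg v → v ≢ 0# → ¬ NonNeg w
¬NonNeg-by-neg {v} {w} -w≡v v≥0 v≢0 w≥0 =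
  v≢0 (trans (sym -w≡v) (cong neg (NonNeg-antisym w≥0 (subst NonNeg (sym -w≡v) v≥0))))

a+a≡0⇒a≡0 : ∀ {a} → a ℤ.+ a ≡ + 0 → a ≡ + 0
a+a≡0⇒a≡0 {+ n} 2n≡0 = cong +_ (m+n≡0⇒m≡0 n (ℤₚ.+-injective 2n≡0))

√2·w≡0⇒w≡0 : ∀ {w} → √2· w ≡ 0# → w ≡ 0#
√2·w≡0⇒w≡0 {a ⊹ b} eq = cong₂ _⊹_ (cong irr eq) (a+a≡0⇒a≡0 (cong rat eq))

√2+1⊗√2-1⊗ : ∀ w → √2+1 ⊗ (√2-1 ⊗ w) ≡ w
√2+1⊗√2-1⊗ (a ⊹ b) = cong₂ _⊹_ (solve (a ∷ b ∷ [])) (solve (a ∷ b ∷ []))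

√2-1⊗w≡0⇒w≡0 : ∀ {w} → √2-1 ⊗ w ≡ 0# → w ≡ 0#
√2-1⊗w≡0⇒w≡0 {w} eq = trans (sym (√2+1⊗√2-1⊗ w)) (cong (√2+1 ⊗_) eq)

√2-1⊗-≢0# : ∀ {w} → w ≢ 0# → √2-1 ⊗ w ≢ 0#
√2-1⊗-≢0# w≢0 = w≢0 ∘ √2-1⊗w≡0⇒w≡0

√2·-≢0# : ∀ {w} → w ≢ 0# → √2· w ≢ 0#
√2·-≢0# w≢0 = w≢0 ∘ √2·w≡0⇒w≡0

neg-≢0# : ∀ {w} → w ≢ 0# → neg w ≢ 0#
neg-≢0# {a ⊹ b} w≢0 -w≡0 =
  w≢0 (cong₂ _⊹_ (neg-zero (cong rat -w≡0)) (neg-zero (cong irr -w≡0)))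
  where
  neg-zero : ∀ {x} → ℤ.- x ≡ + 0 → x ≡ + 0
  neg-zero {x} -x≡0 = trans (sym (ℤₚ.neg-involutive x)) (cong ℤ.-_ -x≡0)

¬NonNeg-by-sum : ∀ {v w c} → w ⊕ v ≡ c → NonNeg v → ¬ NonNeg c → ¬ NonNeg w
¬NonNeg-by-sum w+v≡c v≥0 c≱0 w≥0 = c≱0 (subst NonNeg w+v≡c (NonNeg-⊕ w≥0 v≥0))

¬NonNeg-double : ∀ {w} → ¬ NonNeg (w ⊕ w) → ¬ NonNeg w
¬NonNeg-double 2w≱0 w≥0 = 2w≱0 (NonNeg-⊕ w≥0 w≥0)

-- Since w = (√2 + 1)(√2 - 1)w, a negative (√2 - 1)w would make w negative.
NonNeg-√2-1⊗ : ∀ {w} → NonNeg w → NonNeg (√2-1 ⊗ w)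
NonNeg-√2-1⊗ {a ⊹ b} w≥0 = NonNeg-by-contraposition w≥0
  (λ -u≥0 → subst NonNeg (sym (unfold a b)) (NonNeg-⊕ (NonNeg-√2· -u≥0) -u≥0)) (cong (√2-1 ⊗_))
  where
  unfold : ∀ a b → neg (a ⊹ b) ≡ √2· neg (√2-1 ⊗ (a ⊹ b)) ⊕ neg (√2-1 ⊗ (a ⊹ b))
  unfold a b = cong₂ _⊹_ (solve (a ∷ b ∷ [])) (solve (a ∷ b ∷ []))

NonNeg-halve : ∀ {w} → NonNeg (w ⊕ w) → NonNeg w
NonNeg-halve {a ⊹ b} 2w≥0 = NonNeg-by-contraposition 2w≥0
  (λ -w≥0 → subst NonNeg (sym (neg-⊕ a b)) (NonNeg-⊕ -w≥0 -w≥0))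
  (λ 2w≡0 → cong₂ _⊹_ (a+a≡0⇒a≡0 (cong rat 2w≡0)) (a+a≡0⇒a≡0 (cong irr 2w≡0)))
  where
  neg-⊕ : ∀ a b → neg ((a ⊹ b) ⊕ (a ⊹ b)) ≡ neg (a ⊹ b) ⊕ neg (a ⊹ b)
  neg-⊕ a b = cong₂ _⊹_ (solve (a ∷ b ∷ [])) (solve (a ∷ b ∷ []))

decide-NonNeg : ∀ w {w≥0 : True (nonNeg? w)} → NonNeg w
decide-NonNeg w {w≥0} = toWitness w≥0

decide-¬NonNeg : ∀ w {w≱0 : False (nonNeg? w)} → ¬ NonNeg w
decide-¬NonNeg w {w≱0} = toWitnessFalse w≱0

infix 7.5 _√2-_
_√2-_ : ℤ → ℤ → ℤ[√2]
N √2- R = ℤ.- R ⊹ N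

A-unique : ∀ N R → NonNeg (+ N √2- + R) → ¬ NonNeg (+ N √2- + suc R) → A N ≡ R
A-unique N R (nonNeg R≤N√2) N√2≱R+1 = ≤-antisym
  (≤-pred (≰⇒> λ R+1≤A → N√2≱R+1
    (nonNeg $ subst (ℤ._≤ + A N) (sym (ℤₚ.neg-involutive (+ suc R))) (+≤+ R+1≤A))))
  (ℤₚ.drop‿+≤+ (subst (ℤ._≤ + A N) (ℤₚ.neg-involutive (+ R)) R≤N√2))

-- Images of words under morphisms

Prefix-cong : ∀ {C : Set} (l : List C) {y y′ : ℕ → C} → (∀ i → y i ≡ y′ i) → Prefix l y → Prefix l y′
Prefix-cong [] _ _ = tt
Prefix-cong (c ∷ l) y≗y′ (c≡y₀ , rest) = trans c≡y₀ (y≗y′ 0) , Prefix-cong l (y≗y′ ∘ suc) rest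

Prefix-++ : ∀ {C : Set} (xs ys : List C) {y : ℕ → C} →
            Prefix xs y → Prefix ys (λ i → y (length xs + i)) → Prefix (xs ++ ys) y
Prefix-++ [] ys _ ys-prefix = ys-prefix
Prefix-++ (c ∷ xs) ys (c≡y₀ , xs-prefix) ys-prefix = c≡y₀ , Prefix-++ xs ys xs-prefix ys-prefix

Prefix-agree : ∀ {C : Set} (l : List C) {y y′ : ℕ → C} →
               Prefix l y → Prefix l y′ → ∀ i → i < length l → y i ≡ y′ i
Prefix-agree (c ∷ l) (c≡y₀ , _) (c≡y′₀ , _) zero _ = trans (sym c≡y₀) c≡y′₀
Prefix-agree (c ∷ l) (_ , rest) (_ , rest′) (suc i) (s≤s i<l) = Prefix-agree l rest rest′ i i<l

take-cong : ∀ {B : Set} n {w w′ : ℕ → B} → (∀ i → i < n → w i ≡ w′ i) → take n w ≡ take n w′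
take-cong zero _ = refl
take-cong (suc n) w≗w′ = cong₂ _∷_ (w≗w′ 0 z<s) (take-cong n λ i i<n → w≗w′ (suc i) (s<s i<n))

IsImage-cong : ∀ {B C : Set} (h : B → List C) {w w′ : ℕ → B} {y : ℕ → C} →
               (∀ i → w i ≡ w′ i) → IsImage h w y → IsImage h w′ y
IsImage-cong h {y = y} w≗w′ w↦y n =
  subst (λ l → Prefix (concatMap h l) y) (take-cong n λ i _ → w≗w′ i) (w↦y n)

module _ {B C : Set} (h : B → List C) (w : ℕ → B) (y : ℕ → C) (start : ℕ → ℕ)
         (start-zero : start 0 ≡ 0) (start-suc : ∀ k → start (suc k) ≡ start k + length (h (w k)))
         (block : ∀ k → Prefix (h (w k)) (λ i → y (start k + i))) where

  private
    images-from : ∀ n k → Prefix (concatMap h (take n (λ i → w (k + i)))) (λ i → y (start k + i))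
    images-from zero k = tt
    images-from (suc n) k = Prefix-++ (h (w (k + 0))) _
      (subst (λ j → Prefix (h (w j)) (λ i → y (start k + i))) (sym (+-identityʳ k)) (block k))
      (Prefix-cong _ (λ i → cong y (start-shift i))
        (subst (λ l → Prefix (concatMap h l) _) (take-cong n λ i _ → cong w (sym (+-suc k i)))
          (images-from n (suc k))))
      where
      start-shift : ∀ i → start (suc k) + i ≡ start k + (length (h (w (k + 0))) + i)
      start-shift i rewrite +-identityʳ k | start-suc k = +-assoc (start k) (length (h (w k))) i

  IsImage-by-blocks : IsImage h w y
  IsImage-by-blocks n = Prefix-cong _ (λ i → cong (λ j → y (j + i)) start-zero) (images-from n 0)

module _ {B : Set} (h : B → List B) (non-erasing : ∀ b → 1 ≤ length (h b)) where

  length-image-≥ : ∀ n (w : ℕ → B) → n ≤ length (concatMap h (take n w))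
  length-image-≥ zero w = z≤n
  length-image-≥ (suc n) w = subst (suc n ≤_) (sym (length-++ (h (w 0))))
    (+-mono-≤ (non-erasing (w 0)) (length-image-≥ n (w ∘ suc)))

  -- h(x₀ ⋯ xₙ₋₁) has more than n letters, so the first n letters of a fixed point
  -- determine the next one.
  fixed-point-unique : ∀ {x y : ℕ → B} → x 0 ≡ y 0 → 2 ≤ length (h (x 0)) →
                       IsImage h x x → IsImage h y y → ∀ i → x i ≡ y i
  fixed-point-unique {x} {y} x₀≡y₀ growing x↦x y↦y i = agree-below (suc i) i ≤-refl
    where
    agree-at : ∀ n → (∀ i → i < n → x i ≡ y i) → x n ≡ y n
    agree-at zero _ = x₀≡y₀
    agree-at (suc n) below = Prefix-agree (concatMap h (take (suc n) x)) (x↦x (suc n))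
      (subst (λ l → Prefix (concatMap h l) y) (sym (take-cong (suc n) below)) (y↦y (suc n)))
      (suc n) (subst (suc n <_) (sym (length-++ (h (x 0))))
        (+-mono-≤ growing (length-image-≥ n (x ∘ suc))))
    agree-below : ∀ n i → i < n → x i ≡ y i
    agree-below (suc n) i i<1+n with m<1+n⇒m<n∨m≡n i<1+n
    ... | inj₁ i<n = agree-below n i i<n
    ... | inj₂ refl = agree-at n (agree-below n)

-- The coding of the rotation by √2

θ 1+θ 1-θ : ℤ → ℤ → ℤ[√2]
θ K M = ℤ.- (M ℤ.+ M) ⊹ K
1+θ K M = (+ 1 ℤ.- (M ℤ.+ M)) ⊹ K
1-θ K M = (+ 1 ℤ.+ (M ℤ.+ M)) ⊹ ℤ.- K

neg-[1-X] : ∀ X → ℤ.- (+ 1 ℤ.- X) ≡ X ℤ.+ -[1+ 0 ]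
neg-[1-X] X = solve (X ∷ [])

n≤⌈n/2⌉+⌈n/2⌉ : ∀ n → n ≤ ⌈ n /2⌉ + ⌈ n /2⌉
n≤⌈n/2⌉+⌈n/2⌉ n = subst (_≤ ⌈ n /2⌉ + ⌈ n /2⌉) (⌊n/2⌋+⌈n/2⌉≡n n) (+-monoˡ-≤ ⌈ n /2⌉ (⌊n/2⌋≤⌈n/2⌉ n))

⌈n/2⌉+⌈n/2⌉≤1+n : ∀ n → ⌈ n /2⌉ + ⌈ n /2⌉ ≤ suc n
⌈n/2⌉+⌈n/2⌉≤1+n n = subst (⌈ n /2⌉ + ⌈ n /2⌉ ≤_) (⌊n/2⌋+⌈n/2⌉≡n (suc n))
  (+-monoʳ-≤ ⌈ n /2⌉ (⌊n/2⌋≤⌈n/2⌉ (suc n)))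

n+n≤1⇒n≡0 : ∀ {n} → n + n ≤ 1 → n ≡ 0
n+n≤1⇒n≡0 {zero} _ = refl
n+n≤1⇒n≡0 {suc n} (s≤s n+1+n≤0) = contradiction (subst (_≤ 0) (+-suc n n) n+1+n≤0) λ ()

NonNeg-1+θ⇒2M≤1+A : ∀ k M → NonNeg (1+θ (+ k) (+ M)) → M + M ≤ suc (A k)
NonNeg-1+θ⇒2M≤1+A k M (nonNeg 1+θ≥0) = subst (M + M ≤_) (+-comm (A k) 1)
  (⊖-≤-+⁻¹ (M + M) 1 (A k) (subst (ℤ._≤ + A k) (neg-[1-X] (+ (M + M))) 1+θ≥0))

-- m k is the integer M with |k√2 - 2M| ≤ 1. It is kept abstract so that unification
-- never unfolds isqrt.
abstract
  m : ℕ → ℕ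
  m k = ⌈ A k /2⌉

  m-zero : m 0 ≡ 0
  m-zero = refl

  m-lower : ∀ k → NonNeg (1+θ (+ k) (+ m k))
  m-lower k = nonNeg $ subst (ℤ._≤ + A k) (sym (neg-[1-X] (+ (m k + m k))))
    (⊖-≤-+ (subst (m k + m k ≤_) (+-comm 1 (A k)) (⌈n/2⌉+⌈n/2⌉≤1+n (A k))))

  m-upper : ∀ k → NonNeg (1-θ (+ k) (+ m k))
  m-upper zero = nonNeg -≤+
  m-upper (suc k) = nonNeg (-≤- (n≤⌈n/2⌉+⌈n/2⌉ (A (suc k))))

  m-unique : ∀ k M → NonNeg (1+θ (+ k) (+ M)) → NonNeg (1-θ (+ k) (+ M)) → m k ≡ M
  m-unique zero M 1+θ≥0 _ = sym (n+n≤1⇒n≡0 (NonNeg-1+θ⇒2M≤1+A 0 M 1+θ≥0))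
  m-unique (suc k) M 1+θ≥0 (nonNeg (-≤- A≤2M))
    with m≤n⇒m<n∨m≡n (NonNeg-1+θ⇒2M≤1+A (suc k) M 1+θ≥0)
  ... | inj₁ 2M<A+1 = trans (cong ⌈_/2⌉ (≤-antisym A≤2M (≤-pred 2M<A+1))) (sym (n≡⌈n+n/2⌉ M))
  ... | inj₂ 2M≡A+1 = trans (cong ⌊_/2⌋ (sym 2M≡A+1)) (sym (n≡⌊n+n/2⌋ M))

√2-2 : ℤ[√2]
√2-2 = ℤ.- + 2 ⊹ + 1

Θ : ℕ → ℤ[√2]
Θ k = θ (+ k) (+ m k)

classify : ∀ {P Q : Set} → Dec P → Dec Q → Letter
classify (yes _) _ = l3
classify (no _) (yes _) = l1
classify (no _) (no _) = l2

coding : ℕ → Letter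
coding k = classify (nonNeg? (Θ k ⊕ √2-2)) (nonNeg? (Θ k ⊕ √2-1))

data Region (k : ℕ) : Letter → Set where
  region1 : NonNeg (neg (Θ k ⊕ √2-2)) → NonNeg (Θ k ⊕ √2-1) → Region k l1
  region2 : NonNeg (neg (Θ k ⊕ √2-2)) → NonNeg (neg (Θ k ⊕ √2-1)) → Region k l2
  region3 : NonNeg (Θ k ⊕ √2-2) → Region k l3

region : ∀ k → Region k (coding k)
region k = classify-region (nonNeg? (Θ k ⊕ √2-2)) (nonNeg? (Θ k ⊕ √2-1))
  where
  classify-region : (d : Dec (NonNeg (Θ k ⊕ √2-2))) (e : Dec (NonNeg (Θ k ⊕ √2-1))) →
                    Region k (classify d e)
  classify-region (yes Θ≥2-√2) _ = region3 Θ≥2-√2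
  classify-region (no Θ≱2-√2) (yes Θ≥1-√2) = region1 (¬NonNeg⇒NonNeg-neg Θ≱2-√2) Θ≥1-√2
  classify-region (no Θ≱2-√2) (no Θ≱1-√2) =
    region2 (¬NonNeg⇒NonNeg-neg Θ≱2-√2) (¬NonNeg⇒NonNeg-neg Θ≱1-√2)

coding≡l1 : ∀ {k M} → m k ≡ M →
            ¬ NonNeg (θ (+ k) (+ M) ⊕ √2-2) → NonNeg (θ (+ k) (+ M) ⊕ √2-1) → coding k ≡ l1
coding≡l1 {k} refl Θ≱2-√2 Θ≥1-√2 with nonNeg? (Θ k ⊕ √2-2) | nonNeg? (Θ k ⊕ √2-1)
... | yes Θ≥2-√2 | _ = contradiction Θ≥2-√2 Θ≱2-√2
... | no _ | yes _ = refl
... | no _ | no Θ≱1-√2 = contradiction Θ≥1-√2 Θ≱1-√2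

coding≡l2 : ∀ {k M} → m k ≡ M →
            ¬ NonNeg (θ (+ k) (+ M) ⊕ √2-2) → ¬ NonNeg (θ (+ k) (+ M) ⊕ √2-1) → coding k ≡ l2
coding≡l2 {k} refl Θ≱2-√2 Θ≱1-√2 with nonNeg? (Θ k ⊕ √2-2) | nonNeg? (Θ k ⊕ √2-1)
... | yes Θ≥2-√2 | _ = contradiction Θ≥2-√2 Θ≱2-√2
... | no _ | yes Θ≥1-√2 = contradiction Θ≥1-√2 Θ≱1-√2
... | no _ | no _ = refl

coding≡l3 : ∀ {k M} → m k ≡ M → NonNeg (θ (+ k) (+ M) ⊕ √2-2) → coding k ≡ l3
coding≡l3 {k} refl Θ≥2-√2 with nonNeg? (Θ k ⊕ √2-2)
... | yes _ = refl
... | no Θ≱2-√2 = contradiction Θ≥2-√2 Θ≱2-√2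

θ≥2-√2⇒θ≥1-√2 : ∀ K M → NonNeg (θ K M ⊕ √2-2) → NonNeg (θ K M ⊕ √2-1)
θ≥2-√2⇒θ≥1-√2 K M θ≥2-√2 = subst NonNeg (sym (shift K M)) (NonNeg-⊕ θ≥2-√2 (decide-NonNeg 1#))
  where
  shift : ∀ K M → θ K M ⊕ √2-1 ≡ θ K M ⊕ √2-2 ⊕ 1#
  shift K M = cong₂ _⊹_ (solve (K ∷ M ∷ [])) (solve (K ∷ M ∷ []))

m-step-up : ∀ k → NonNeg (Θ k ⊕ √2-1) → m (suc k) ≡ suc (m k)
m-step-up k Θ≥1-√2 = m-unique (suc k) (suc (m k))
  (subst NonNeg (sym (lower (+ k) (+ m k))) Θ≥1-√2)
  (subst NonNeg (sym (upper (+ k) (+ m k))) (NonNeg-⊕ (m-upper k) (decide-NonNeg (+ 2 ⊹ ℤ.- + 1))))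
  where
  lower : ∀ K M → 1+θ (+ 1 ℤ.+ K) (+ 1 ℤ.+ M) ≡ θ K M ⊕ √2-1
  lower K M = cong₂ _⊹_ (solve (K ∷ M ∷ [])) (solve (K ∷ M ∷ []))
  upper : ∀ K M → 1-θ (+ 1 ℤ.+ K) (+ 1 ℤ.+ M) ≡ 1-θ K M ⊕ (+ 2 ⊹ ℤ.- + 1)
  upper K M = cong₂ _⊹_ (solve (K ∷ M ∷ [])) (solve (K ∷ M ∷ []))

m-step-flat : ∀ k → NonNeg (neg (Θ k ⊕ √2-1)) → m (suc k) ≡ m k
m-step-flat k Θ≤1-√2 = m-unique (suc k) (m k)
  (subst NonNeg (sym (lower (+ k) (+ m k))) (NonNeg-⊕ (m-lower k) (decide-NonNeg (+ 0 ⊹ + 1))))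
  (subst NonNeg (sym (upper (+ k) (+ m k))) Θ≤1-√2)
  where
  lower : ∀ K M → 1+θ (+ 1 ℤ.+ K) M ≡ 1+θ K M ⊕ (+ 0 ⊹ + 1)
  lower K M = cong₂ _⊹_ (solve (K ∷ M ∷ [])) (solve (K ∷ M ∷ []))
  upper : ∀ K M → 1-θ (+ 1 ℤ.+ K) M ≡ neg (θ K M ⊕ √2-1)
  upper K M = cong₂ _⊹_ (solve (K ∷ M ∷ [])) (solve (K ∷ M ∷ []))

Θ≡ : ∀ {j M} → m j ≡ M → Θ j ≡ θ (+ j) (+ M)
Θ≡ {j} = cong (λ M → θ (+ j) (+ M))

θ⊕≢0# : ∀ k M c → θ (+ k) M ⊕ (c ⊹ + 1) ≢ 0#
θ⊕≢0# k M c w≡0 = 1+n≢0 (trans (+-comm 1 k) (ℤₚ.+-injective (cong irr w≡0)))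

-- x_k's images σ(x_k) and δ(x_k) start at positions L k in x and P k in ΔAA.
L P : ℕ → ℕ
L k = k + (m k + m k)
P k = k + m k

-- In the identities below, ℓ and p stand for L k and P k written over ℤ, so that the ring
-- solver sees K = k and M = m k as variables.
module _ (k : ℕ) where
  private
    K = + k
    M = + m k

    [√2-1][1+θ]≥0 : NonNeg (√2-1 ⊗ 1+θ K M)
    [√2-1][1+θ]≥0 = NonNeg-√2-1⊗ (m-lower k)

    [√2-1][1-θ]≥0 : NonNeg (√2-1 ⊗ 1-θ K M)
    [√2-1][1-θ]≥0 = NonNeg-√2-1⊗ (m-upper k)

  m[L]≡k+m : m (L k) ≡ k + m k
  m[L]≡k+m = m-unique (L k) (k + m k)
    (subst NonNeg (sym (lower K M)) (NonNeg-⊕ [√2-1][1-θ]≥0 (decide-NonNeg (+ 2 ⊹ ℤ.- + 1))))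
    (subst NonNeg (sym (upper K M)) (NonNeg-⊕ [√2-1][1+θ]≥0 (decide-NonNeg (+ 2 ⊹ ℤ.- + 1))))
    where
    lower : ∀ K M → let ℓ = K ℤ.+ (M ℤ.+ M) ; p = K ℤ.+ M in
            1+θ ℓ p ≡ √2-1 ⊗ 1-θ K M ⊕ (+ 2 ⊹ ℤ.- + 1)
    lower K M = cong₂ _⊹_ (solve (K ∷ M ∷ [])) (solve (K ∷ M ∷ []))
    upper : ∀ K M → let ℓ = K ℤ.+ (M ℤ.+ M) ; p = K ℤ.+ M in
            1-θ ℓ p ≡ √2-1 ⊗ 1+θ K M ⊕ (+ 2 ⊹ ℤ.- + 1)
    upper K M = cong₂ _⊹_ (solve (K ∷ M ∷ [])) (solve (K ∷ M ∷ []))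

  Θ[L]≥1-√2 : NonNeg (θ (+ L k) (+ (k + m k)) ⊕ √2-1)
  Θ[L]≥1-√2 = subst NonNeg (sym (scaled K M)) [√2-1][1-θ]≥0
    where
    scaled : ∀ K M → let ℓ = K ℤ.+ (M ℤ.+ M) ; p = K ℤ.+ M in θ ℓ p ⊕ √2-1 ≡ √2-1 ⊗ 1-θ K M
    scaled K M = cong₂ _⊹_ (solve (K ∷ M ∷ [])) (solve (K ∷ M ∷ []))

  coding[L]≡l1 : coding (L k) ≡ l1
  coding[L]≡l1 = coding≡l1 m[L]≡k+m Θ[L]≱2-√2 Θ[L]≥1-√2
    where
    sum : ∀ K M → let ℓ = K ℤ.+ (M ℤ.+ M) ; p = K ℤ.+ M in
          θ ℓ p ⊕ √2-2 ⊕ √2-1 ⊗ 1+θ K M ≡ ℤ.- + 3 ⊹ + 2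
    sum K M = cong₂ _⊹_ (solve (K ∷ M ∷ [])) (solve (K ∷ M ∷ []))
    Θ[L]≱2-√2 : ¬ NonNeg (θ (+ L k) (+ (k + m k)) ⊕ √2-2)
    Θ[L]≱2-√2 = ¬NonNeg-by-sum (sum K M) [√2-1][1+θ]≥0 (decide-¬NonNeg (ℤ.- + 3 ⊹ + 2))

  m[1+L]≡1+k+m : m (suc (L k)) ≡ suc (k + m k)
  m[1+L]≡1+k+m = trans
    (m-step-up (L k) (subst (λ Θ → NonNeg (Θ ⊕ √2-1)) (sym (Θ≡ m[L]≡k+m)) Θ[L]≥1-√2))
    (cong suc m[L]≡k+m)

  Θ[1+L]≱1-√2 : NonNeg (Θ k ⊕ √2-1) → ¬ NonNeg (θ (+ suc (L k)) (+ suc (k + m k)) ⊕ √2-1)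
  Θ[1+L]≱1-√2 Θ≥1-√2 =
    ¬NonNeg-by-neg (reflected K M) (NonNeg-√2-1⊗ Θ≥1-√2) (√2-1⊗-≢0# (θ⊕≢0# k M (ℤ.- + 1)))
    where
    reflected : ∀ K M → let ℓ = K ℤ.+ (M ℤ.+ M) ; p = K ℤ.+ M in
                neg (θ (+ 1 ℤ.+ ℓ) (+ 1 ℤ.+ p) ⊕ √2-1) ≡ √2-1 ⊗ (θ K M ⊕ √2-1)
    reflected K M = cong₂ _⊹_ (solve (K ∷ M ∷ [])) (solve (K ∷ M ∷ []))

  coding[1+L]≡l2 : NonNeg (Θ k ⊕ √2-1) → coding (suc (L k)) ≡ l2
  coding[1+L]≡l2 Θ≥1-√2 = coding≡l2 m[1+L]≡1+k+m
    (Θ[1+L]≱1-√2 Θ≥1-√2 ∘ θ≥2-√2⇒θ≥1-√2 (+ suc (L k)) (+ suc (k + m k))) (Θ[1+L]≱1-√2 Θ≥1-√2)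

  m[2+L]≡1+k+m : NonNeg (Θ k ⊕ √2-1) → m (suc (suc (L k))) ≡ suc (k + m k)
  m[2+L]≡1+k+m Θ≥1-√2 = trans (m-step-flat (suc (L k)) (¬NonNeg⇒NonNeg-neg Θ[1+L]≱1-√2′)) m[1+L]≡1+k+m
    where
    Θ[1+L]≱1-√2′ : ¬ NonNeg (Θ (suc (L k)) ⊕ √2-1)
    Θ[1+L]≱1-√2′ = subst (λ Θ → ¬ NonNeg (Θ ⊕ √2-1)) (sym (Θ≡ m[1+L]≡1+k+m)) (Θ[1+L]≱1-√2 Θ≥1-√2)

  coding[2+L]≡l3 : NonNeg (neg (Θ k ⊕ √2-2)) → NonNeg (Θ k ⊕ √2-1) → coding (suc (suc (L k))) ≡ l3
  coding[2+L]≡l3 Θ≤2-√2 Θ≥1-√2 = coding≡l3 (m[2+L]≡1+k+m Θ≥1-√2)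
    (subst NonNeg (sym (scaled K M)) (NonNeg-√2-1⊗ Θ≤2-√2))
    where
    scaled : ∀ K M → let ℓ = K ℤ.+ (M ℤ.+ M) ; p = K ℤ.+ M in
             θ (+ 2 ℤ.+ ℓ) (+ 1 ℤ.+ p) ⊕ √2-2 ≡ √2-1 ⊗ neg (θ K M ⊕ √2-2)
    scaled K M = cong₂ _⊹_ (solve (K ∷ M ∷ [])) (solve (K ∷ M ∷ []))

  coding[2+L]≡l1 : NonNeg (Θ k ⊕ √2-2) → coding (suc (suc (L k))) ≡ l1
  coding[2+L]≡l1 Θ≥2-√2 = coding≡l1 (m[2+L]≡1+k+m (θ≥2-√2⇒θ≥1-√2 K M Θ≥2-√2))
    (¬NonNeg-by-neg (reflected K M) (NonNeg-√2-1⊗ Θ≥2-√2) (√2-1⊗-≢0# (θ⊕≢0# k M (ℤ.- + 2))))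
    (subst NonNeg (sym (scaled K M)) (NonNeg-√2-1⊗ (NonNeg-⊕ (m-upper k) (decide-NonNeg (+ 2 ⊹ + 0)))))
    where
    reflected : ∀ K M → let ℓ = K ℤ.+ (M ℤ.+ M) ; p = K ℤ.+ M in
                neg (θ (+ 2 ℤ.+ ℓ) (+ 1 ℤ.+ p) ⊕ √2-2) ≡ √2-1 ⊗ (θ K M ⊕ √2-2)
    reflected K M = cong₂ _⊹_ (solve (K ∷ M ∷ [])) (solve (K ∷ M ∷ []))
    scaled : ∀ K M → let ℓ = K ℤ.+ (M ℤ.+ M) ; p = K ℤ.+ M in
             θ (+ 2 ℤ.+ ℓ) (+ 1 ℤ.+ p) ⊕ √2-1 ≡ √2-1 ⊗ (1-θ K M ⊕ (+ 2 ⊹ + 0))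
    scaled K M = cong₂ _⊹_ (solve (K ∷ M ∷ [])) (solve (K ∷ M ∷ []))

  -- Near 1 + P and 2 + P the bounds are ((2 - √2)(1 ± θ) + c)/2, so they are stated doubled.
  A[1+P]≡1+L : A (suc (P k)) ≡ suc (L k)
  A[1+P]≡1+L = A-unique (suc (P k)) (suc (L k))
    (NonNeg-halve (subst NonNeg (sym (lower K M))
      (NonNeg-⊕ (NonNeg-√2· [√2-1][1+θ]≥0) (decide-NonNeg (ℤ.- + 4 ⊹ + 3)))))
    (¬NonNeg-double (¬NonNeg-by-sum (upper K M) (NonNeg-√2· [√2-1][1-θ]≥0) (decide-¬NonNeg (ℤ.- + 2 ⊹ + 1))))
    where
    lower : ∀ K M → let ℓ = K ℤ.+ (M ℤ.+ M) ; p = K ℤ.+ M ; w = (+ 1 ℤ.+ p) √2- (+ 1 ℤ.+ ℓ) in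
            w ⊕ w ≡ √2· (√2-1 ⊗ 1+θ K M) ⊕ (ℤ.- + 4 ⊹ + 3)
    lower K M = cong₂ _⊹_ (solve (K ∷ M ∷ [])) (solve (K ∷ M ∷ []))
    upper : ∀ K M → let ℓ = K ℤ.+ (M ℤ.+ M) ; p = K ℤ.+ M ; w = (+ 1 ℤ.+ p) √2- (+ 2 ℤ.+ ℓ) in
            w ⊕ w ⊕ √2· (√2-1 ⊗ 1-θ K M) ≡ ℤ.- + 2 ⊹ + 1
    upper K M = cong₂ _⊹_ (solve (K ∷ M ∷ [])) (solve (K ∷ M ∷ []))

  A[1+L]≡1+2P : A (suc (L k)) ≡ suc (P k + P k)
  A[1+L]≡1+2P = A-unique (suc (L k)) (suc (P k + P k))
    (subst NonNeg (sym (lower K M)) [√2-1][1-θ]≥0)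
    (¬NonNeg-by-sum (upper K M) [√2-1][1+θ]≥0 (decide-¬NonNeg (ℤ.- + 3 ⊹ + 2)))
    where
    lower : ∀ K M → let ℓ = K ℤ.+ (M ℤ.+ M) ; p = K ℤ.+ M in
            (+ 1 ℤ.+ ℓ) √2- (+ 1 ℤ.+ (p ℤ.+ p)) ≡ √2-1 ⊗ 1-θ K M
    lower K M = cong₂ _⊹_ (solve (K ∷ M ∷ [])) (solve (K ∷ M ∷ []))
    upper : ∀ K M → let ℓ = K ℤ.+ (M ℤ.+ M) ; p = K ℤ.+ M in
            (+ 1 ℤ.+ ℓ) √2- (+ 2 ℤ.+ (p ℤ.+ p)) ⊕ √2-1 ⊗ 1+θ K M ≡ ℤ.- + 3 ⊹ + 2
    upper K M = cong₂ _⊹_ (solve (K ∷ M ∷ [])) (solve (K ∷ M ∷ []))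

  A[2+P]≡2+L : NonNeg (neg (Θ k ⊕ √2-2)) → A (suc (suc (P k))) ≡ suc (suc (L k))
  A[2+P]≡2+L Θ≤2-√2 = A-unique (suc (suc (P k))) (suc (suc (L k)))
    (NonNeg-halve (subst NonNeg (sym (lower K M))
      (NonNeg-⊕ (NonNeg-√2· [√2-1][1+θ]≥0) (decide-NonNeg (ℤ.- + 6 ⊹ + 5)))))
    (¬NonNeg-double (¬NonNeg-by-neg (upper K M) (NonNeg-√2· (NonNeg-√2-1⊗ Θ≤2-√2))
      (√2·-≢0# (√2-1⊗-≢0# (neg-≢0# (θ⊕≢0# k M (ℤ.- + 2)))))))
    where
    lower : ∀ K M → let ℓ = K ℤ.+ (M ℤ.+ M) ; p = K ℤ.+ M ; w = (+ 2 ℤ.+ p) √2- (+ 2 ℤ.+ ℓ) in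
            w ⊕ w ≡ √2· (√2-1 ⊗ 1+θ K M) ⊕ (ℤ.- + 6 ⊹ + 5)
    lower K M = cong₂ _⊹_ (solve (K ∷ M ∷ [])) (solve (K ∷ M ∷ []))
    upper : ∀ K M → let ℓ = K ℤ.+ (M ℤ.+ M) ; p = K ℤ.+ M ; w = (+ 2 ℤ.+ p) √2- (+ 3 ℤ.+ ℓ) in
            neg (w ⊕ w) ≡ √2· (√2-1 ⊗ neg (θ K M ⊕ √2-2))
    upper K M = cong₂ _⊹_ (solve (K ∷ M ∷ [])) (solve (K ∷ M ∷ []))

  A[2+P]≡3+L : NonNeg (Θ k ⊕ √2-2) → A (suc (suc (P k))) ≡ suc (suc (suc (L k)))
  A[2+P]≡3+L Θ≥2-√2 = A-unique (suc (suc (P k))) (suc (suc (suc (L k))))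
    (NonNeg-halve (subst NonNeg (sym (lower K M)) (NonNeg-√2· (NonNeg-√2-1⊗ Θ≥2-√2))))
    (¬NonNeg-double (¬NonNeg-by-sum (upper K M) (NonNeg-√2· [√2-1][1-θ]≥0) (decide-¬NonNeg (ℤ.- + 6 ⊹ + 3))))
    where
    lower : ∀ K M → let ℓ = K ℤ.+ (M ℤ.+ M) ; p = K ℤ.+ M ; w = (+ 2 ℤ.+ p) √2- (+ 3 ℤ.+ ℓ) in
            w ⊕ w ≡ √2· (√2-1 ⊗ (θ K M ⊕ √2-2))
    lower K M = cong₂ _⊹_ (solve (K ∷ M ∷ [])) (solve (K ∷ M ∷ []))
    upper : ∀ K M → let ℓ = K ℤ.+ (M ℤ.+ M) ; p = K ℤ.+ M ; w = (+ 2 ℤ.+ p) √2- (+ 4 ℤ.+ ℓ) in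
            w ⊕ w ⊕ √2· (√2-1 ⊗ 1-θ K M) ≡ ℤ.- + 6 ⊹ + 3
    upper K M = cong₂ _⊹_ (solve (K ∷ M ∷ [])) (solve (K ∷ M ∷ []))

  A[2+L]≡2+2P : NonNeg (Θ k ⊕ √2-1) → A (suc (suc (L k))) ≡ suc (suc (P k + P k))
  A[2+L]≡2+2P Θ≥1-√2 = A-unique (suc (suc (L k))) (suc (suc (P k + P k)))
    (subst NonNeg (sym (lower K M)) (NonNeg-√2-1⊗ (NonNeg-⊕ (m-upper k) (decide-NonNeg 1#))))
    (¬NonNeg-by-neg (upper K M) (NonNeg-√2-1⊗ Θ≥1-√2) (√2-1⊗-≢0# (θ⊕≢0# k M (ℤ.- + 1))))
    where
    lower : ∀ K M → let ℓ = K ℤ.+ (M ℤ.+ M) ; p = K ℤ.+ M in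
            (+ 2 ℤ.+ ℓ) √2- (+ 2 ℤ.+ (p ℤ.+ p)) ≡ √2-1 ⊗ (1-θ K M ⊕ 1#)
    lower K M = cong₂ _⊹_ (solve (K ∷ M ∷ [])) (solve (K ∷ M ∷ []))
    upper : ∀ K M → let ℓ = K ℤ.+ (M ℤ.+ M) ; p = K ℤ.+ M in
            neg ((+ 2 ℤ.+ ℓ) √2- (+ 3 ℤ.+ (p ℤ.+ p))) ≡ √2-1 ⊗ (θ K M ⊕ √2-1)
    upper K M = cong₂ _⊹_ (solve (K ∷ M ∷ [])) (solve (K ∷ M ∷ []))

  A[2+L]≡3+2P : NonNeg (neg (Θ k ⊕ √2-1)) → A (suc (suc (L k))) ≡ suc (suc (suc (P k + P k)))
  A[2+L]≡3+2P Θ≤1-√2 = A-unique (suc (suc (L k))) (suc (suc (suc (P k + P k))))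
    (subst NonNeg (sym (lower K M)) (NonNeg-√2-1⊗ Θ≤1-√2))
    (¬NonNeg-by-sum (upper K M) [√2-1][1+θ]≥0 (decide-¬NonNeg (ℤ.- + 5 ⊹ + 3)))
    where
    lower : ∀ K M → let ℓ = K ℤ.+ (M ℤ.+ M) ; p = K ℤ.+ M in
            (+ 2 ℤ.+ ℓ) √2- (+ 3 ℤ.+ (p ℤ.+ p)) ≡ √2-1 ⊗ neg (θ K M ⊕ √2-1)
    lower K M = cong₂ _⊹_ (solve (K ∷ M ∷ [])) (solve (K ∷ M ∷ []))
    upper : ∀ K M → let ℓ = K ℤ.+ (M ℤ.+ M) ; p = K ℤ.+ M in
            (+ 2 ℤ.+ ℓ) √2- (+ 4 ℤ.+ (p ℤ.+ p)) ⊕ √2-1 ⊗ 1+θ K M ≡ ℤ.- + 5 ⊹ + 3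
    upper K M = cong₂ _⊹_ (solve (K ∷ M ∷ [])) (solve (K ∷ M ∷ []))

  A[3+L]≡3+2P : NonNeg (Θ k ⊕ √2-2) → A (suc (suc (suc (L k)))) ≡ suc (suc (suc (P k + P k)))
  A[3+L]≡3+2P Θ≥2-√2 = A-unique (suc (suc (suc (L k)))) (suc (suc (suc (P k + P k))))
    (subst NonNeg (sym (lower K M)) (NonNeg-√2-1⊗ (NonNeg-⊕ (m-upper k) (decide-NonNeg (+ 2 ⊹ + 0)))))
    (¬NonNeg-by-neg (upper K M) (NonNeg-√2-1⊗ Θ≥2-√2) (√2-1⊗-≢0# (θ⊕≢0# k M (ℤ.- + 2))))
    where
    lower : ∀ K M → let ℓ = K ℤ.+ (M ℤ.+ M) ; p = K ℤ.+ M in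
            (+ 3 ℤ.+ ℓ) √2- (+ 3 ℤ.+ (p ℤ.+ p)) ≡ √2-1 ⊗ (1-θ K M ⊕ (+ 2 ⊹ + 0))
    lower K M = cong₂ _⊹_ (solve (K ∷ M ∷ [])) (solve (K ∷ M ∷ []))
    upper : ∀ K M → let ℓ = K ℤ.+ (M ℤ.+ M) ; p = K ℤ.+ M in
            neg ((+ 3 ℤ.+ ℓ) √2- (+ 4 ℤ.+ (p ℤ.+ p))) ≡ √2-1 ⊗ (θ K M ⊕ √2-2)
    upper K M = cong₂ _⊹_ (solve (K ∷ M ∷ [])) (solve (K ∷ M ∷ []))

-- x = σ(x) and ΔAA = δ(x)

coding[0]≡l1 : coding 0 ≡ l1
coding[0]≡l1 =
  coding≡l1 m-zero (decide-¬NonNeg (θ (+ 0) (+ 0) ⊕ √2-2)) (decide-NonNeg (θ (+ 0) (+ 0) ⊕ √2-1))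

rise : Letter → ℕ
rise l1 = 1
rise l2 = 0
rise l3 = 1

m-suc : ∀ k → m (suc k) ≡ rise (coding k) + m k
m-suc k with coding k | region k
... | .l1 | region1 _ Θ≥1-√2 = m-step-up k Θ≥1-√2
... | .l2 | region2 _ Θ≤1-√2 = m-step-flat k Θ≤1-√2
... | .l3 | region3 Θ≥2-√2 = m-step-up k (θ≥2-√2⇒θ≥1-√2 (+ k) (+ m k) Θ≥2-√2)

length-σ : ∀ c → length (σ c) ≡ suc (rise c + rise c)
length-σ l1 = refl
length-σ l2 = refl
length-σ l3 = refl

length-δ : ∀ c → length (δ c) ≡ suc (rise c)
length-δ l1 = refl
length-δ l2 = refl
length-δ l3 = refl

L-suc : ∀ k → L (suc k) ≡ L k + length (σ (coding k))
L-suc k rewrite m-suc k | length-σ (coding k) = shift k (m k) (rise (coding k))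
  where
  shift : ∀ k m r → suc k + ((r + m) + (r + m)) ≡ k + (m + m) + suc (r + r)
  shift = solve-∀

P-suc : ∀ k → P (suc k) ≡ P k + length (δ (coding k))
P-suc k rewrite m-suc k | length-δ (coding k) = shift k (m k) (rise (coding k))
  where
  shift : ∀ k m r → suc k + (r + m) ≡ k + m + suc r
  shift = solve-∀

letter-at : ∀ {C : Set} (y : ℕ → C) j i {c} → y (i + j) ≡ c → c ≡ y (j + i)
letter-at y j i y[i+j]≡c = trans (sym y[i+j]≡c) (cong y (+-comm i j))

σ-block : ∀ k → Prefix (σ (coding k)) (λ i → coding (L k + i))
σ-block k with coding k | region k
... | .l1 | region1 Θ≤2-√2 Θ≥1-√2 =
  at 0 (coding[L]≡l1 k) , at 1 (coding[1+L]≡l2 k Θ≥1-√2) , at 2 (coding[2+L]≡l3 k Θ≤2-√2 Θ≥1-√2) , tt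
  where at = letter-at coding (L k)
... | .l2 | region2 _ _ = letter-at coding (L k) 0 (coding[L]≡l1 k) , tt
... | .l3 | region3 Θ≥2-√2 =
  at 0 (coding[L]≡l1 k) , at 1 (coding[1+L]≡l2 k Θ≥1-√2) , at 2 (coding[2+L]≡l1 k Θ≥2-√2) , tt
  where
  at = letter-at coding (L k)
  Θ≥1-√2 = θ≥2-√2⇒θ≥1-√2 (+ k) (+ m k) Θ≥2-√2

ΔAA-from : ∀ i c → A (A (suc (suc i))) ≡ c + A (A (suc i)) → ΔAA i ≡ c
ΔAA-from i c eq = trans (cong (_∸ A (A (suc i))) eq) (m+n∸n≡m c (A (A (suc i))))

A[A[1+P]]≡1+2P : ∀ k → A (A (suc (P k))) ≡ suc (P k + P k)
A[A[1+P]]≡1+2P k = trans (cong A (A[1+P]≡1+L k)) (A[1+L]≡1+2P k)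

A[A[3+P]]≡5+2P : ∀ k → m (suc k) ≡ suc (m k) → A (A (3 + P k)) ≡ 5 + (P k + P k)
A[A[3+P]]≡5+2P k m-rises = begin
  A (A (3 + P k))                 ≡⟨ cong (λ p → A (A (suc p))) P[1+k]≡2+P ⟨
  A (A (suc (P (suc k))))         ≡⟨ A[A[1+P]]≡1+2P (suc k) ⟩
  suc (P (suc k) + P (suc k))     ≡⟨ cong (λ p → suc (p + p)) P[1+k]≡2+P ⟩
  suc ((2 + P k) + (2 + P k))     ≡⟨ regroup (P k) ⟩
  5 + (P k + P k)                 ∎
  where
  open ≡-Reasoning
  regroup : ∀ p → suc ((2 + p) + (2 + p)) ≡ 5 + (p + p)
  regroup = solve-∀
  P[1+k]≡2+P : P (suc k) ≡ 2 + P k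
  P[1+k]≡2+P = trans (cong (λ x → suc k + x) m-rises) (cong suc (+-suc k (m k)))

δ-block : ∀ k → Prefix (δ (coding k)) (λ i → ΔAA (P k + i))
δ-block k with coding k | region k
... | .l1 | region1 Θ≤2-√2 Θ≥1-√2 = at 0 ΔAA[P]≡1 , at 1 ΔAA[1+P]≡3 , tt
  where
  at = letter-at ΔAA (P k)
  A[A[2+P]]≡2+2P : A (A (2 + P k)) ≡ 2 + (P k + P k)
  A[A[2+P]]≡2+2P = trans (cong A (A[2+P]≡2+L k Θ≤2-√2)) (A[2+L]≡2+2P k Θ≥1-√2)
  ΔAA[P]≡1 : ΔAA (P k) ≡ 1
  ΔAA[P]≡1 = ΔAA-from (P k) 1 (trans A[A[2+P]]≡2+2P (cong suc (sym (A[A[1+P]]≡1+2P k))))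
  ΔAA[1+P]≡3 : ΔAA (suc (P k)) ≡ 3
  ΔAA[1+P]≡3 = ΔAA-from (suc (P k)) 3 (trans (A[A[3+P]]≡5+2P k (m-step-up k Θ≥1-√2))
    (cong (λ x → 3 + x) (sym A[A[2+P]]≡2+2P)))
... | .l2 | region2 Θ≤2-√2 Θ≤1-√2 = letter-at ΔAA (P k) 0 ΔAA[P]≡2 , tt
  where
  ΔAA[P]≡2 : ΔAA (P k) ≡ 2
  ΔAA[P]≡2 = ΔAA-from (P k) 2 (trans (cong A (A[2+P]≡2+L k Θ≤2-√2))
    (trans (A[2+L]≡3+2P k Θ≤1-√2) (cong (λ x → 2 + x) (sym (A[A[1+P]]≡1+2P k)))))
... | .l3 | region3 Θ≥2-√2 = at 0 ΔAA[P]≡2 , at 1 ΔAA[1+P]≡2 , tt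
  where
  at = letter-at ΔAA (P k)
  A[A[2+P]]≡3+2P : A (A (2 + P k)) ≡ 3 + (P k + P k)
  A[A[2+P]]≡3+2P = trans (cong A (A[2+P]≡3+L k Θ≥2-√2)) (A[3+L]≡3+2P k Θ≥2-√2)
  ΔAA[P]≡2 : ΔAA (P k) ≡ 2
  ΔAA[P]≡2 = ΔAA-from (P k) 2 (trans A[A[2+P]]≡3+2P (cong (λ x → 2 + x) (sym (A[A[1+P]]≡1+2P k))))
  ΔAA[1+P]≡2 : ΔAA (suc (P k)) ≡ 2
  ΔAA[1+P]≡2 = ΔAA-from (suc (P k)) 2
    (trans (A[A[3+P]]≡5+2P k (m-step-up k (θ≥2-√2⇒θ≥1-√2 (+ k) (+ m k) Θ≥2-√2)))
      (cong (λ x → 2 + x) (sym A[A[2+P]]≡3+2P)))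

coding-fixed : IsImage σ coding coding
coding-fixed = IsImage-by-blocks σ coding coding L (cong (λ M → M + M) m-zero) L-suc σ-block

coding↦ΔAA : IsImage δ coding ΔAA
coding↦ΔAA = IsImage-by-blocks δ coding ΔAA P m-zero P-suc δ-block

σ-non-erasing : ∀ c → 1 ≤ length (σ c)
σ-non-erasing l1 = s≤s z≤n
σ-non-erasing l2 = s≤s z≤n
σ-non-erasing l3 = s≤s z≤n

coding-unique : ∀ x → x 0 ≡ l1 → IsImage σ x x → ∀ i → coding i ≡ x i
coding-unique x x₀≡l1 = fixed-point-unique σ σ-non-erasing (trans coding[0]≡l1 (sym x₀≡l1))
  (subst (λ c → 2 ≤ length (σ c)) (sym coding[0]≡l1) (s≤s (s≤s z≤n))) coding-fixed

theorem7 : (Σ (ℕ → Letter) (λ x → (x 0 ≡ l1) × IsImage σ x x))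
         × ((x : ℕ → Letter) → x 0 ≡ l1 → IsImage σ x x → IsImage δ x ΔAA)
theorem7 =
  (coding , coding[0]≡l1 , coding-fixed) ,
  λ x x₀≡l1 x↦x → IsImage-cong δ (coding-unique x x₀≡l1 x↦x) coding↦ΔAA
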